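{- Let $G$ be a graph, connected or otherwise. Then there exists a distance exceptional graph $G'$ containing a copy of $G$ as an induced subgraph. If $G$ is connected and $\iota(G)<\infty$, then this embedding can be taken to be isometric (i.e. distances in $G$ between vertices of the copy equal their distances in $G'$).
   Context: All graphs are finite, simple, undirected. For a connected graph $G$ with vertices $v_1,\dots,v_n$, $D=(d(v_i,v_j))_{i,j}$ is its shortest-path distance matrix and $\vec 1$ the all-ones vector. A curvature potential is a vector $\vec x$ with $D\vec x=\vec 1$; a connected graph is distance exceptional if it has no curvature potential. Let $X(G)=\{D\vec x:\vec x\in\mathbb{R}^n,\ \vec x^\top\vec 1=1\}$. If $G$ is distance exceptional or has a curvature potential $\vec x$ with $\vec 1^\top\vec x\ne 0$, then $X(G)\cap\mathbb{R}\vec 1$ is a single point, and the curvature index $\iota(G)\in\mathbb{R}$ is defined by $X(G)\cap\mathbb{R}\vec 1=\{\iota(G)\vec 1\}$; otherwise $\iota(G):=\infty$.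
   Formalization: Curvature potentials are taken over ℚ instead of ℝ, both for distance exceptionality of G′ and for the condition $\iota(G)<\infty$. -}

module Defs where

open import Data.Bool using (Bool; true; false; _∧_; _∨_; if_then_else_)
open import Data.Nat using (ℕ; zero; suc)
open import Data.Fin using (Fin; zero; suc)
open import Data.Fin.Properties using (_≟_)
open import Data.Integer using (+_)
open import Data.Rational using (ℚ; _+_; _*_; _/_; 0ℚ; 1ℚ)
open import Data.Product using (∃; Σ; _×_)
open import Data.Sum using (_⊎_)
open import Function.Definitions using (Injective)
open import Relation.Binary.PropositionalEquality using (_≡_)
open import Relation.Nullary using (¬_)
open import Relation.Nullary.Decidable using (⌊_⌋)

record Graph : Set where
  field
    n    : ℕ
    adj  : Fin n → Fin n → Bool
    sym  : ∀ u v → adj u v ≡ adj v u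
    irr  : ∀ u → adj u u ≡ false
open Graph public

anyFin : ∀ {m} → (Fin m → Bool) → Bool
anyFin {zero}  p = false
anyFin {suc m} p = p zero ∨ anyFin (λ i → p (suc i))

reach : (G : Graph) → ℕ → Fin (n G) → Fin (n G) → Bool
reach G zero    u v = ⌊ u ≟ v ⌋
reach G (suc k) u v = reach G k u v ∨ anyFin (λ w → reach G k u w ∧ adj G w v)

Connected : Graph → Set
Connected G = ∀ u v → ∃ λ k → reach G k u v ≡ true

-- shortest-path distance: least k with a walk of length ≤ k
-- (search k = 0,1,...,n; every connected graph reaches within n - 1 steps;
--  the default value n for unreachable pairs is never used for connected graphs)
distSearch : (G : Graph) → Fin (n G) → Fin (n G) → ℕ → ℕ → ℕ
distSearch G u v zero     k = k
distSearch G u v (suc f)  k = if reach G k u v then k else distSearch G u v f (suc k)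

dist : (G : Graph) → Fin (n G) → Fin (n G) → ℕ
dist G u v = distSearch G u v (n G) 0

Σℚ : ∀ {m} → (Fin m → ℚ) → ℚ
Σℚ {zero}  f = 0ℚ
Σℚ {suc m} f = f zero + Σℚ (λ i → f (suc i))

ℕtoℚ : ℕ → ℚ
ℕtoℚ k = (+ k) / 1

IsCurvaturePotential : (G : Graph) → (Fin (n G) → ℚ) → Set
IsCurvaturePotential G x = ∀ i → Σℚ (λ j → ℕtoℚ (dist G i j) * x j) ≡ 1ℚ

DistanceExceptional : Graph → Set
DistanceExceptional G =
  Connected G × ¬ (Σ (Fin (n G) → ℚ) λ x → IsCurvaturePotential G x)

-- ι(G) < ∞  (for connected G): G is distance exceptional, or it has a
-- curvature potential x with 1ᵀx ≠ 0.
IotaFinite : Graph → Set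
IotaFinite G =
  DistanceExceptional G
  ⊎ (Σ (Fin (n G) → ℚ) λ x → IsCurvaturePotential G x × ¬ (Σℚ x ≡ 0ℚ))

InducedEmbedding : (G H : Graph) → (Fin (n G) → Fin (n H)) → Set
InducedEmbedding G H f = Injective _≡_ _≡_ f × (∀ u v → adj H (f u) (f v) ≡ adj G u v)

Isometric : (G H : Graph) → (Fin (n G) → Fin (n H)) → Set
Isometric G H f = ∀ u v → dist H (f u) (f v) ≡ dist G u v

-- If D y = 0 for a weighting y with 1ᵀy = 1, then G is distance exceptional: a potential x
-- would give 1 = yᵀ D x = (D y)ᵀ x = 0, D being symmetric.
--
-- For arbitrary G, adjoin four apices adjacent to everything, two vertices adjacent to all of
-- G and one vertex adjacent only to the apices. The result has diameter 2, and in every row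
-- of its distance matrix the entries at the apices sum to the entries at the other three new
-- vertices; so y = +1 on the apices and −1 on the other three new vertices works, and G sits
-- inside as an induced subgraph.
--
-- For connected G with ι(G) < ∞, normalise a potential to y with 1ᵀy = 1 and D y = ι(G) 1.
-- Gluing graphs at a vertex (the wedge sum) is isometric on both sides and adds the indices:
-- distances in G₁ ⋁ G₂ split as d₁ + d₂ along the two retractions onto G₁ and G₂, and the
-- two weightings combine. Writing (d + 1) ι(G) = ±a with a ∈ ℕ, the wedge of
-- d + 1 copies of G with a copies of a 7-vertex graph of index −1, or with 2a copies of K₂
-- (index ½), has index 0 and contains G isometrically.

module Submission where

open import Defs renaming (sym to adj-sym; irr to adj-irr)
open import Algebra.Bundles using (CommutativeRing)
open import Data.Bool using (Bool; true; false; _∧_; _∨_; not; if_then_else_; T)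
open import Data.Bool.Properties using (∧-conicalˡ; ∧-conicalʳ; ∧-identityʳ; ∧-zeroʳ; ∨-identityʳ; ∨-zeroʳ; ∨-comm)
open import Data.Nat using (ℕ; zero; suc; _≤_; _<_; _≤′_; z≤n; s≤s; ≤′-refl; ≤′-step) renaming (_+_ to _+ℕ_)
open import Data.Nat.Properties
  using (≤-refl; ≤-trans; ≤-antisym; ≤-total; ≤-reflexive; ≤⇒≤′; ≤∧≢⇒<; <⇒≤; <⇒≱; m≤n+m; m<n⇒m<1+n; n<1+n; n≤0⇒n≡0;
         +-suc; +-identityʳ; +-monoˡ-≤; +-monoʳ-≤)
  renaming (+-comm to +ℕ-comm)
import Data.Nat.Coprimality as Coprimality
import Data.Integer as ℤ
open import Data.Integer.Properties using () renaming (*-identityʳ to *ℤ-identityʳ)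
import Data.Integer.Solver
open import Data.Fin using (Fin; zero; suc; _↑ˡ_; _↑ʳ_; splitAt)
open import Data.Fin.Patterns using (0F; 1F; 2F; 3F; 4F; 5F; 6F)
open import Data.Fin.Properties
  using (_≟_; any?; ↑ˡ-injective; ↑ʳ-injective; splitAt-↑ˡ; splitAt-↑ʳ; splitAt⁻¹-↑ˡ; splitAt⁻¹-↑ʳ)
open import Data.Fin.Subset using (Subset; _∈_; _⊆_; ∣_∣)
open import Data.Fin.Subset.Properties using (_∈?_; ∣p∣≤n; ∣⊥∣≡0; p⊂q⇒∣p∣<∣q∣; ∉⊥)
open import Data.Vec using (tabulate)
open import Data.Vec.Properties using (lookup∘tabulate; []=⇒lookup; lookup⇒[]=)
open import Data.Rational using (ℚ; mkℚ; _+_; _*_; _-_; -_; _/_; 0ℚ; 1ℚ; ½; 1/_; NonZero; ≢-nonZero)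
open import Data.Rational.Properties
  using (+-*-commutativeRing; normalize-coprime; +-identityˡ; +-assoc; +-comm; *-assoc; *-comm; *-zeroˡ; *-zeroʳ;
         *-identityˡ; *-identityʳ; *-inverseʳ; *-distribʳ-+; 1≢0; toℚᵘ-injective; toℚᵘ-homo-*; toℚᵘ-cong)
open import Data.Rational.Unnormalised using (*≡*)
import Data.Rational.Unnormalised.Properties as ℚᵘ
open import Data.Rational.Solver using (module +-*-Solver)
open import Algebra.Properties.Semiring.Sum (CommutativeRing.semiring +-*-commutativeRing)
  using (sum; sum-cong-≗; ∑-distrib-+; ∑-comm; *-distribˡ-sum; *-distribʳ-sum; sum-replicate-zero)
open import Data.Product using (∃; ∃₂; Σ; _×_; _,_)
open import Data.Sum using (_⊎_; inj₁; inj₂; [_,_]′)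
open import Relation.Binary.PropositionalEquality
  using (_≡_; _≢_; refl; sym; trans; cong; cong₂; subst; module ≡-Reasoning)
open import Relation.Nullary using (¬_; yes; no; contradiction)
open import Relation.Nullary.Decidable using (⌊_⌋; isYes≗does; dec-true; toWitness; _×-dec_; ¬?)

∨-introˡ : ∀ {x y} → x ≡ true → x ∨ y ≡ true
∨-introˡ refl = refl

∨-introʳ : ∀ {x y} → y ≡ true → x ∨ y ≡ true
∨-introʳ {x} refl = ∨-zeroʳ x

∨-elim : ∀ x {y} → x ∨ y ≡ true → x ≡ true ⊎ y ≡ true
∨-elim true  _ = inj₁ refl
∨-elim false e = inj₂ e

∧-intro : ∀ {x y} → x ≡ true → y ≡ true → x ∧ y ≡ true
∧-intro refl refl = refl

anyFin-intro : ∀ {m} (p : Fin m → Bool) i → p i ≡ true → anyFin p ≡ true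
anyFin-intro p zero    e = ∨-introˡ e
anyFin-intro p (suc i) e = ∨-introʳ (anyFin-intro (λ j → p (suc j)) i e)

anyFin-elim : ∀ {m} (p : Fin m → Bool) → anyFin p ≡ true → ∃ λ i → p i ≡ true
anyFin-elim {suc m} p e with ∨-elim (p zero) e
... | inj₁ e₀ = zero , e₀
... | inj₂ e₁ with anyFin-elim (λ j → p (suc j)) e₁
...   | i , eᵢ = suc i , eᵢ

⌊≟⌋-refl : ∀ {m} (u : Fin m) → ⌊ u ≟ u ⌋ ≡ true
⌊≟⌋-refl u = trans (isYes≗does (u ≟ u)) (dec-true (u ≟ u) refl)

⌊≟⌋-true : ∀ {m} {u v : Fin m} → ⌊ u ≟ v ⌋ ≡ true → u ≡ v
⌊≟⌋-true e = toWitness (subst T (sym e) _)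

⌊≟⌋-sym : ∀ {m} (u v : Fin m) → ⌊ u ≟ v ⌋ ≡ ⌊ v ≟ u ⌋
⌊≟⌋-sym u v with u ≟ v | v ≟ u
... | yes _   | yes _   = refl
... | no _    | no _    = refl
... | yes u≡v | no v≢u  = contradiction (sym u≡v) v≢u
... | no u≢v  | yes v≡u = contradiction (sym v≡u) u≢v

symmetrise : ∀ {k} → (Fin k → Fin k → Bool) → Fin k → Fin k → Bool
symmetrise E u v = not ⌊ u ≟ v ⌋ ∧ (E u v ∨ E v u)

symmetrise-sym : ∀ {k} (E : Fin k → Fin k → Bool) u v → symmetrise E u v ≡ symmetrise E v u
symmetrise-sym E u v = cong₂ (λ b c → not b ∧ c) (⌊≟⌋-sym u v) (∨-comm (E u v) (E v u))

symmetrise-irr : ∀ {k} (E : Fin k → Fin k → Bool) u → symmetrise E u u ≡ false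
symmetrise-irr E u = cong (λ b → not b ∧ (E u u ∨ E u u)) (⌊≟⌋-refl u)

-- Walks and distances

module _ (G : Graph) where

  data Walk≤ : ℕ → Fin (n G) → Fin (n G) → Set where
    here : ∀ {k u} → Walk≤ k u u
    _▷_  : ∀ {k u w v} → Walk≤ k u w → adj G w v ≡ true → Walk≤ (suc k) u v

  infixl 5 _▷_

  walk-suc : ∀ {k u v} → Walk≤ k u v → Walk≤ (suc k) u v
  walk-suc here    = here
  walk-suc (p ▷ e) = walk-suc p ▷ e

  walk-mono : ∀ {j k u v} → j ≤ k → Walk≤ j u v → Walk≤ k u v
  walk-mono j≤k = go (≤⇒≤′ j≤k)
    where
    go : ∀ {j k u v} → j ≤′ k → Walk≤ j u v → Walk≤ k u v
    go ≤′-refl       p = p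
    go (≤′-step j≤k) p = walk-suc (go j≤k p)

  walk-cast : ∀ {j k u v} → j ≡ k → Walk≤ j u v → Walk≤ k u v
  walk-cast refl p = p

  walk-weaken : ∀ j {k u v} → Walk≤ k u v → Walk≤ (j +ℕ k) u v
  walk-weaken zero    p = p
  walk-weaken (suc j) p = walk-suc (walk-weaken j p)

  -- The length is written k + j so that recursion on the second walk needs no arithmetic.
  _++_ : ∀ {j k u w v} → Walk≤ j u w → Walk≤ k w v → Walk≤ (k +ℕ j) u v
  p ++ here {k} = walk-weaken k p
  p ++ (q ▷ e)  = (p ++ q) ▷ e

  _◁_ : ∀ {k u w v} → adj G u w ≡ true → Walk≤ k w v → Walk≤ (suc k) u v
  e ◁ here     = here ▷ e
  e ◁ (p ▷ e′) = (e ◁ p) ▷ e′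

  walk-reverse : ∀ {k u v} → Walk≤ k u v → Walk≤ k v u
  walk-reverse here                  = here
  walk-reverse (_▷_ {w = w} {v} p e) = trans (adj-sym G v w) e ◁ walk-reverse p

  walk-zero⁻ : ∀ {u v} → Walk≤ 0 u v → u ≡ v
  walk-zero⁻ here = refl

  walk-one⁻ : ∀ {u v} → Walk≤ 1 u v → u ≡ v ⊎ adj G u v ≡ true
  walk-one⁻ here       = inj₁ refl
  walk-one⁻ (here ▷ e) = inj₂ e

  walk-lipschitz : (f : Fin (n G) → ℕ) → (∀ a b → adj G a b ≡ true → f b ≤ suc (f a)) →
                   ∀ {k u v} → Walk≤ k u v → f v ≤ k +ℕ f u
  walk-lipschitz f lip here    = m≤n+m _ _
  walk-lipschitz f lip (_▷_ {w = w} {v} p e) = ≤-trans (lip w v e) (s≤s (walk-lipschitz f lip p))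

  walk⇒reach : ∀ {k u v} → Walk≤ k u v → reach G k u v ≡ true
  walk⇒reach {zero}  here    = ⌊≟⌋-refl _
  walk⇒reach {suc k} here    = ∨-introˡ (walk⇒reach {k} here)
  walk⇒reach (_▷_ {w = w} p e) = ∨-introʳ (anyFin-intro _ w (∧-intro (walk⇒reach p) e))

  reach⇒walk : ∀ k {u v} → reach G k u v ≡ true → Walk≤ k u v
  reach⇒walk zero    r with ⌊≟⌋-true r
  ... | refl = here
  reach⇒walk (suc k) {u} {v} r with ∨-elim (reach G k u v) r
  ... | inj₁ r′ = walk-suc (reach⇒walk k r′)
  ... | inj₂ r′ with anyFin-elim (λ w → reach G k u w ∧ adj G w v) r′
  ...   | w , r″ = reach⇒walk k (∧-conicalˡ _ _ r″) ▷ ∧-conicalʳ _ _ r″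

walk-map : ∀ {G H} (φ : Fin (n G) → Fin (n H)) → (∀ {a b} → adj G a b ≡ true → adj H (φ a) (φ b) ≡ true) →
           ∀ {k u v} → Walk≤ G k u v → Walk≤ H k (φ u) (φ v)
walk-map φ hom here    = here
walk-map φ hom (p ▷ e) = walk-map φ hom p ▷ hom e

module Saturation (G : Graph) (u : Fin (n G)) where

  Ball : ℕ → Subset (n G)
  Ball k = tabulate (reach G k u)

  ∈-Ball : ∀ k {v} → Walk≤ G k u v → v ∈ Ball k
  ∈-Ball k {v} p = lookup⇒[]= v (Ball k) (trans (lookup∘tabulate (reach G k u) v) (walk⇒reach G p))

  ∈-Ball⁻ : ∀ k {v} → v ∈ Ball k → Walk≤ G k u v
  ∈-Ball⁻ k {v} v∈ = reach⇒walk G k (trans (sym (lookup∘tabulate (reach G k u) v)) ([]=⇒lookup v∈))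

  Ball-stable : ∀ j → Ball (suc j) ⊆ Ball j → ∀ {k v} → j ≤′ k → Walk≤ G k u v → Walk≤ G j u v
  Ball-stable j s ≤′-refl       p       = p
  Ball-stable j s (≤′-step j≤k) here    = here
  Ball-stable j s (≤′-step j≤k) (p ▷ e) = ∈-Ball⁻ j (s (∈-Ball (suc j) (Ball-stable j s j≤k p ▷ e)))

  -- Pigeonhole: as long as the balls around u keep growing, Ball k has more than k vertices.
  Ball-grows : ∀ k → (∃ λ j → j < k × Ball (suc j) ⊆ Ball j) ⊎ k < ∣ Ball k ∣
  Ball-grows zero = inj₂ (subst (_< ∣ Ball 0 ∣) (∣⊥∣≡0 (n G))
    (p⊂q⇒∣p∣<∣q∣ ((λ x∈⊥ → contradiction x∈⊥ ∉⊥) , u , ∈-Ball 0 here , ∉⊥)))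
  Ball-grows (suc k) with Ball-grows k
  ... | inj₁ (j , j<k , s) = inj₁ (j , m<n⇒m<1+n j<k , s)
  ... | inj₂ k<∣B∣ with any? (λ v → v ∈? Ball (suc k) ×-dec ¬? (v ∈? Ball k))
  ...   | yes (v , v∈ , v∉) = inj₂ (≤-trans (s≤s k<∣B∣) (p⊂q⇒∣p∣<∣q∣ (Ball-suc , v , v∈ , v∉)))
    where
    Ball-suc : Ball k ⊆ Ball (suc k)
    Ball-suc v∈′ = ∈-Ball (suc k) (walk-suc G (∈-Ball⁻ k v∈′))
  ...   | no ∄ = inj₁ (k , n<1+n k , λ {v} v∈ → decide v v∈)
    where
    decide : ∀ v → v ∈ Ball (suc k) → v ∈ Ball k
    decide v v∈ with v ∈? Ball k
    ... | yes v∈′ = v∈′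
    ... | no v∉   = contradiction (v , v∈ , v∉) ∄

  saturate : ∀ {k v} → Walk≤ G k u v → Walk≤ G (n G) u v
  saturate {k} p with Ball-grows (n G)
  ... | inj₂ n<∣B∣ = contradiction (∣p∣≤n (Ball (n G))) (<⇒≱ n<∣B∣)
  ... | inj₁ (j , j<n , s) with ≤-total k j
  ...   | inj₁ k≤j = walk-mono G (≤-trans k≤j (<⇒≤ j<n)) p
  ...   | inj₂ j≤k = walk-mono G (<⇒≤ j<n) (Ball-stable j s (≤⇒≤′ j≤k) p)

module _ (G : Graph) where

  open Saturation G using (saturate)

  private
    skip-unreached : ∀ {s k u v} → reach G s u v ≡ false → s ≤ k → Walk≤ G k u v → s < k
    skip-unreached r≡false s≤k p =
      ≤∧≢⇒< s≤k λ { refl → contradiction (trans (sym r≡false) (walk⇒reach G p)) λ () }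

  distSearch-≤ : ∀ {k u v} F s → s ≤ k → Walk≤ G k u v → distSearch G u v F s ≤ k
  distSearch-≤ zero s s≤k p = s≤k
  distSearch-≤ {u = u} {v} (suc F) s s≤k p with reach G s u v in eq
  ... | true  = s≤k
  ... | false = distSearch-≤ F (suc s) (skip-unreached eq s≤k p) p

  distSearch-walk : ∀ {k u v} F s → s ≤ k → k ≤ s +ℕ F → Walk≤ G k u v → Walk≤ G (distSearch G u v F s) u v
  distSearch-walk zero s s≤k k≤s+0 p = walk-mono G (≤-trans k≤s+0 (≤-reflexive (+-identityʳ s))) p
  distSearch-walk {k} {u} {v} (suc F) s s≤k k≤s+F p with reach G s u v in eq
  ... | true  = reach⇒walk G s eq
  ... | false = distSearch-walk F (suc s) (skip-unreached eq s≤k p) (subst (k ≤_) (+-suc s F) k≤s+F) p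

  dist-≤ : ∀ {k u v} → Walk≤ G k u v → dist G u v ≤ k
  dist-≤ = distSearch-≤ (n G) 0 z≤n

  dist-walk : Connected G → ∀ u v → Walk≤ G (dist G u v) u v
  dist-walk C u v with C u v
  ... | k , r = distSearch-walk (n G) 0 z≤n ≤-refl (saturate u (reach⇒walk G k r))

  dist-unique : Connected G → ∀ {k u v} → Walk≤ G k u v → (∀ {j} → Walk≤ G j u v → k ≤ j) → dist G u v ≡ k
  dist-unique C {u = u} {v} p minimal = ≤-antisym (dist-≤ p) (minimal (dist-walk C u v))

  dist-self : ∀ u → dist G u u ≡ 0
  dist-self u = n≤0⇒n≡0 (dist-≤ here)

  dist-sym : Connected G → ∀ u v → dist G u v ≡ dist G v u
  dist-sym C u v = ≤-antisym (dist-≤ (walk-reverse G (dist-walk C v u)))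
                             (dist-≤ (walk-reverse G (dist-walk C u v)))

  dist-step : Connected G → ∀ u a b → adj G a b ≡ true → dist G u b ≤ suc (dist G u a)
  dist-step C u a b e = dist-≤ (dist-walk C u a ▷ e)

hop : (G : Graph) → Fin (n G) → Fin (n G) → ℕ
hop G u v = if ⌊ u ≟ v ⌋ then 0 else if adj G u v then 1 else 2

module _ (G : Graph) (c : Fin (n G)) (universal : ∀ v → c ≢ v → adj G c v ≡ true) where

  walk-to-centre : ∀ u → Walk≤ G 1 u c
  walk-to-centre u with u ≟ c
  ... | yes refl = here
  ... | no u≢c   = here ▷ trans (adj-sym G u c) (universal u (λ c≡u → u≢c (sym c≡u)))

  walk-via-centre : ∀ u v → Walk≤ G 2 u v
  walk-via-centre u v = _++_ G (walk-to-centre u) (walk-reverse G (walk-to-centre v))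

  universal⇒connected : Connected G
  universal⇒connected u v = 2 , walk⇒reach G (walk-via-centre u v)

  dist-universal : ∀ u v → dist G u v ≡ hop G u v
  dist-universal u v with u ≟ v
  ... | yes refl = dist-self G u
  ... | no u≢v with adj G u v in e
  ...   | true  = dist-unique G universal⇒connected (here ▷ e) one-≤
    where
    one-≤ : ∀ {j} → Walk≤ G j u v → 1 ≤ j
    one-≤ {zero}  p = contradiction (walk-zero⁻ G p) u≢v
    one-≤ {suc j} p = s≤s z≤n
  ...   | false = dist-unique G universal⇒connected (walk-via-centre u v) two-≤
    where
    two-≤ : ∀ {j} → Walk≤ G j u v → 2 ≤ j
    two-≤ {zero}        p = contradiction (walk-zero⁻ G p) u≢v
    two-≤ {suc zero}    p with walk-one⁻ G p
    ... | inj₁ u≡v = contradiction u≡v u≢v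
    ... | inj₂ e′  = contradiction (trans (sym e′) e) λ ()
    two-≤ {suc (suc j)} p = s≤s (s≤s z≤n)

-- The curvature index

Σℚ≗sum : ∀ {m} (f : Fin m → ℚ) → Σℚ f ≡ sum f
Σℚ≗sum {zero}  f = refl
Σℚ≗sum {suc m} f = cong (f zero +_) (Σℚ≗sum (λ i → f (suc i)))

sum-splitAt : ∀ m {k} (f : Fin (m +ℕ k) → ℚ) → sum f ≡ sum (λ i → f (i ↑ˡ k)) + sum (λ j → f (m ↑ʳ j))
sum-splitAt zero    f = sym (+-identityˡ _)
sum-splitAt (suc m) {k} f =
  trans (cong (f zero +_) (sum-splitAt m (λ i → f (suc i))))
        (sym (+-assoc (f zero) (sum (λ i → f (suc (i ↑ˡ k)))) (sum (λ j → f (suc m ↑ʳ j)))))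

ℕtoℚ≡mkℚ : ∀ a → ℕtoℚ a ≡ mkℚ (ℤ.+ a) 0 (Coprimality.sym (Coprimality.1-coprimeTo a))
ℕtoℚ≡mkℚ a = normalize-coprime (Coprimality.sym (Coprimality.1-coprimeTo a))

ℕtoℚ-+ : ∀ a b → ℕtoℚ (a +ℕ b) ≡ ℕtoℚ a + ℕtoℚ b
ℕtoℚ-+ a b = sym (trans (cong₂ _+_ (ℕtoℚ≡mkℚ a) (ℕtoℚ≡mkℚ b))
                        (cong (_/ 1) (cong₂ ℤ._+_ (*ℤ-identityʳ (ℤ.+ a)) (*ℤ-identityʳ (ℤ.+ b)))))

ℕtoℚ-suc : ∀ c → ℕtoℚ (suc c) ≡ 1ℚ + ℕtoℚ c
ℕtoℚ-suc c = ℕtoℚ-+ 1 c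

record HasIndex (G : Graph) (ι : ℚ) : Set where
  field
    weight : Fin (n G) → ℚ
    row    : ∀ i → sum (λ j → ℕtoℚ (dist G i j) * weight j) ≡ ι
    total  : sum weight ≡ 1ℚ

index-zero⇒exceptional : ∀ G → Connected G → HasIndex G 0ℚ → DistanceExceptional G
index-zero⇒exceptional G C h = C , λ (x , potential) → 1≢0 (begin
  1ℚ
    ≡⟨ sym total ⟩
  sum y
    ≡⟨ sum-cong-≗ (λ i → sym (y·Dx i potential)) ⟩
  sum (λ i → y i * sum (λ j → d i j * x j))
    ≡⟨ sum-cong-≗ (λ i → *-distribˡ-sum (y i) (λ j → d i j * x j)) ⟩
  sum (λ i → sum (λ j → y i * (d i j * x j)))
    ≡⟨ ∑-comm (λ i j → y i * (d i j * x j)) ⟩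
  sum (λ j → sum (λ i → y i * (d i j * x j)))
    ≡⟨ sum-cong-≗ (λ j → sum-cong-≗ (λ i → transpose x i j)) ⟩
  sum (λ j → sum (λ i → (d j i * y i) * x j))
    ≡⟨ sum-cong-≗ (λ j → sym (*-distribʳ-sum (x j) (λ i → d j i * y i))) ⟩
  sum (λ j → sum (λ i → d j i * y i) * x j)
    ≡⟨ sum-cong-≗ (λ j → cong (_* x j) (row j)) ⟩
  sum (λ j → 0ℚ * x j)
    ≡⟨ sum-cong-≗ (λ j → *-zeroˡ (x j)) ⟩
  sum {n G} (λ _ → 0ℚ)
    ≡⟨ sum-replicate-zero (n G) ⟩
  0ℚ
    ∎)
  where
  open ≡-Reasoning
  open HasIndex h renaming (weight to y)
  d : Fin (n G) → Fin (n G) → ℚ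
  d i j = ℕtoℚ (dist G i j)
  y·Dx : ∀ {x} i → IsCurvaturePotential G x → y i * sum (λ j → d i j * x j) ≡ y i
  y·Dx {x} i potential =
    trans (cong (y i *_) (trans (sym (Σℚ≗sum (λ j → d i j * x j))) (potential i))) (*-identityʳ (y i))
  transpose : ∀ (x : Fin (n G) → ℚ) i j → y i * (d i j * x j) ≡ (d j i * y i) * x j
  transpose x i j = begin
    y i * (d i j * x j)  ≡⟨ sym (*-assoc (y i) (d i j) (x j)) ⟩
    (y i * d i j) * x j  ≡⟨ cong (_* x j) (*-comm (y i) (d i j)) ⟩
    (d i j * y i) * x j  ≡⟨ cong (λ k → ℕtoℚ k * y i * x j) (dist-sym G C i j) ⟩
    (d j i * y i) * x j  ∎

potential⇒index : ∀ G x → IsCurvaturePotential G x → (nz : ¬ Σℚ x ≡ 0ℚ) →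
                  HasIndex G ((1/ Σℚ x) {{≢-nonZero nz}})
potential⇒index G x potential nz = record
  { weight = λ j → x j * s
  ; row    = λ i → begin
      sum (λ j → ℕtoℚ (dist G i j) * (x j * s))
        ≡⟨ sum-cong-≗ (λ j → sym (*-assoc (ℕtoℚ (dist G i j)) (x j) s)) ⟩
      sum (λ j → ℕtoℚ (dist G i j) * x j * s)
        ≡⟨ sym (*-distribʳ-sum s (λ j → ℕtoℚ (dist G i j) * x j)) ⟩
      sum (λ j → ℕtoℚ (dist G i j) * x j) * s
        ≡⟨ cong (_* s) (trans (sym (Σℚ≗sum (λ j → ℕtoℚ (dist G i j) * x j))) (potential i)) ⟩
      1ℚ * s
        ≡⟨ *-identityˡ s ⟩
      s ∎
  ; total  = begin
      sum (λ j → x j * s)  ≡⟨ sym (*-distribʳ-sum s x) ⟩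
      sum x * s            ≡⟨ cong (_* s) (sym (Σℚ≗sum x)) ⟩
      Σℚ x * s             ≡⟨ *-inverseʳ (Σℚ x) ⟩
      1ℚ                   ∎
  }
  where
  open ≡-Reasoning
  instance
    Σx≢0 : NonZero (Σℚ x)
    Σx≢0 = ≢-nonZero nz
  s : ℚ
  s = 1/ Σℚ x

-- The gadget

module Gadget (G : Graph) where

  apex : Fin 7 → Bool
  apex 0F = true
  apex 1F = true
  apex 2F = true
  apex 3F = true
  apex _  = false

  apex-edge : Fin 7 → Fin 7 → Bool
  apex-edge s _ = apex s

  attached : Fin 7 → Bool
  attached 6F = false
  attached _  = true

  -- The seven gadget vertices come first: 0–3 are apices adjacent to every other vertex,
  -- 4 and 5 are adjacent to all of G, and 6 only to the apices.
  link : Fin 7 ⊎ Fin (n G) → Fin 7 ⊎ Fin (n G) → Bool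
  link (inj₁ s) (inj₁ t) = symmetrise apex-edge s t
  link (inj₁ s) (inj₂ _) = attached s
  link (inj₂ _) (inj₁ t) = attached t
  link (inj₂ a) (inj₂ b) = adj G a b

  link-sym : ∀ p q → link p q ≡ link q p
  link-sym (inj₁ s) (inj₁ t) = symmetrise-sym apex-edge s t
  link-sym (inj₁ s) (inj₂ _) = refl
  link-sym (inj₂ _) (inj₁ t) = refl
  link-sym (inj₂ a) (inj₂ b) = adj-sym G a b

  link-irr : ∀ p → link p p ≡ false
  link-irr (inj₁ s) = symmetrise-irr apex-edge s
  link-irr (inj₂ a) = adj-irr G a

  G⁺ : Graph
  G⁺ = record
    { n   = 7 +ℕ n G
    ; adj = λ u v → link (splitAt 7 u) (splitAt 7 v)
    ; sym = λ u v → link-sym (splitAt 7 u) (splitAt 7 v)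
    ; irr = λ u → link-irr (splitAt 7 u)
    }

  apex-universal : ∀ v → 0F ≢ v → adj G⁺ 0F v ≡ true
  apex-universal zero    0≢0 = contradiction refl 0≢0
  apex-universal (suc v) _ with splitAt 6 v
  ... | inj₁ _ = refl
  ... | inj₂ _ = refl

  weight : Fin (7 +ℕ n G) → ℚ
  weight v = [ (λ s → if apex s then 1ℚ else - 1ℚ) , (λ _ → 0ℚ) ]′ (splitAt 7 v)

  sum-over-gadget : ∀ (f : Fin (7 +ℕ n G) → ℚ) →
                    sum (λ v → f v * weight v) ≡ sum (λ s → f (s ↑ˡ n G) * weight (s ↑ˡ n G)) + 0ℚ
  sum-over-gadget f = trans (sum-splitAt 7 (λ v → f v * weight v))
    (cong (sum (λ s → f (s ↑ˡ n G) * weight (s ↑ˡ n G)) +_)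
          (trans (sum-cong-≗ (λ v → *-zeroʳ (f (7 ↑ʳ v)))) (sum-replicate-zero (n G))))

  gadget-row : ∀ i → sum (λ s → ℕtoℚ (hop G⁺ i (s ↑ˡ n G)) * weight (s ↑ˡ n G)) ≡ 0ℚ
  gadget-row 0F = refl
  gadget-row 1F = refl
  gadget-row 2F = refl
  gadget-row 3F = refl
  gadget-row 4F = refl
  gadget-row 5F = refl
  gadget-row 6F = refl
  gadget-row (suc (suc (suc (suc (suc (suc (suc v))))))) = refl

  G⁺-index-zero : HasIndex G⁺ 0ℚ
  G⁺-index-zero = record
    { weight = weight
    ; row    = λ i → begin
        sum (λ j → ℕtoℚ (dist G⁺ i j) * weight j)
          ≡⟨ sum-cong-≗ (λ j → cong (λ k → ℕtoℚ k * weight j) (dist-universal G⁺ 0F apex-universal i j)) ⟩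
        sum (λ j → ℕtoℚ (hop G⁺ i j) * weight j)
          ≡⟨ sum-over-gadget (λ j → ℕtoℚ (hop G⁺ i j)) ⟩
        sum (λ s → ℕtoℚ (hop G⁺ i (s ↑ˡ n G)) * weight (s ↑ˡ n G)) + 0ℚ
          ≡⟨ cong (_+ 0ℚ) (gadget-row i) ⟩
        0ℚ ∎
    ; total  = sum-over-gadget (λ _ → 1ℚ)
    }
    where open ≡-Reasoning

  G⁺-exceptional : DistanceExceptional G⁺
  G⁺-exceptional = index-zero⇒exceptional G⁺ (universal⇒connected G⁺ 0F apex-universal) G⁺-index-zero

  G⁺-induced : InducedEmbedding G G⁺ (7 ↑ʳ_)
  G⁺-induced = ↑ʳ-injective 7 _ _ , λ u v → refl

-- Wedge sums

-- A graph on Fin (suc m), rooted at zero.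
record RootedGraph : Set where
  field
    m        : ℕ
    edge     : Fin (suc m) → Fin (suc m) → Bool
    edge-sym : ∀ u v → edge u v ≡ edge v u
    edge-irr : ∀ u → edge u u ≡ false

⌞_⌟ : RootedGraph → Graph
⌞ G ⌟ = record { n = suc m ; adj = edge ; sym = edge-sym ; irr = edge-irr }
  where open RootedGraph G

-- The wedge sum G₁ ⋁ G₂ is the subgraph of the Cartesian product G₁ □ G₂ induced on
-- G₁ × {root} ∪ {root} × G₂; its vertices are those of G₁ followed by the non-root vertices of G₂.
module Wedge (G₁ G₂ : RootedGraph) where

  H₁ H₂ : Graph
  H₁ = ⌞ G₁ ⌟
  H₂ = ⌞ G₂ ⌟

  m₁ m₂ : ℕ
  m₁ = RootedGraph.m G₁
  m₂ = RootedGraph.m G₂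

  V : Set
  V = Fin (suc m₁ +ℕ m₂)

  ρ₁ : V → Fin (suc m₁)
  ρ₁ v = [ (λ a → a) , (λ _ → zero) ]′ (splitAt (suc m₁) v)

  ρ₂ : V → Fin (suc m₂)
  ρ₂ v = [ (λ _ → zero) , suc ]′ (splitAt (suc m₁) v)

  φ₁ : Fin (suc m₁) → V
  φ₁ a = a ↑ˡ m₂

  φ₂ : Fin (suc m₂) → V
  φ₂ zero    = zero
  φ₂ (suc c) = suc m₁ ↑ʳ c

  ρ₁-φ₁ : ∀ a → ρ₁ (φ₁ a) ≡ a
  ρ₁-φ₁ a = cong [ (λ a → a) , (λ _ → zero) ]′ (splitAt-↑ˡ (suc m₁) a m₂)

  ρ₂-φ₁ : ∀ a → ρ₂ (φ₁ a) ≡ zero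
  ρ₂-φ₁ a = cong [ (λ _ → zero) , suc ]′ (splitAt-↑ˡ (suc m₁) a m₂)

  ρ₁-φ₂ : ∀ b → ρ₁ (φ₂ b) ≡ zero
  ρ₁-φ₂ zero    = refl
  ρ₁-φ₂ (suc c) = cong [ (λ a → a) , (λ _ → zero) ]′ (splitAt-↑ʳ (suc m₁) m₂ c)

  ρ₂-φ₂ : ∀ b → ρ₂ (φ₂ b) ≡ b
  ρ₂-φ₂ zero    = refl
  ρ₂-φ₂ (suc c) = cong [ (λ _ → zero) , suc ]′ (splitAt-↑ʳ (suc m₁) m₂ c)

  data View : V → Set where
    left  : ∀ a → View (φ₁ a)
    right : ∀ c → View (φ₂ (suc c))

  view : ∀ v → View v
  view v with splitAt (suc m₁) v in eq
  ... | inj₁ a = subst View (splitAt⁻¹-↑ˡ eq) (left a)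
  ... | inj₂ c = subst View (splitAt⁻¹-↑ʳ eq) (right c)

  adjW : V → V → Bool
  adjW u v = (adj H₁ (ρ₁ u) (ρ₁ v) ∧ ⌊ ρ₂ u ≟ ρ₂ v ⌋) ∨ (⌊ ρ₁ u ≟ ρ₁ v ⌋ ∧ adj H₂ (ρ₂ u) (ρ₂ v))

  adjW-sym : ∀ u v → adjW u v ≡ adjW v u
  adjW-sym u v = cong₂ _∨_ (cong₂ _∧_ (adj-sym H₁ (ρ₁ u) (ρ₁ v)) (⌊≟⌋-sym (ρ₂ u) (ρ₂ v)))
                           (cong₂ _∧_ (⌊≟⌋-sym (ρ₁ u) (ρ₁ v)) (adj-sym H₂ (ρ₂ u) (ρ₂ v)))

  adjW-irr : ∀ u → adjW u u ≡ false
  adjW-irr u rewrite adj-irr H₁ (ρ₁ u) | adj-irr H₂ (ρ₂ u) = ∧-zeroʳ _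

  W : Graph
  W = record { n = suc (m₁ +ℕ m₂) ; adj = adjW ; sym = adjW-sym ; irr = adjW-irr }

  adjW-split : ∀ p q → adjW p q ≡ true →
               (adj H₁ (ρ₁ p) (ρ₁ q) ≡ true × ρ₂ p ≡ ρ₂ q) ⊎ (ρ₁ p ≡ ρ₁ q × adj H₂ (ρ₂ p) (ρ₂ q) ≡ true)
  adjW-split p q e with ∨-elim (adj H₁ (ρ₁ p) (ρ₁ q) ∧ ⌊ ρ₂ p ≟ ρ₂ q ⌋) e
  ... | inj₁ e₁ = inj₁ (∧-conicalˡ _ _ e₁ , ⌊≟⌋-true (∧-conicalʳ _ _ e₁))
  ... | inj₂ e₂ = inj₂ (⌊≟⌋-true (∧-conicalˡ _ _ e₂) , ∧-conicalʳ _ _ e₂)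

  adjW-φ₁ : ∀ a b → adjW (φ₁ a) (φ₁ b) ≡ adj H₁ a b
  adjW-φ₁ a b rewrite ρ₁-φ₁ a | ρ₁-φ₁ b | ρ₂-φ₁ a | ρ₂-φ₁ b | adj-irr H₂ zero =
    trans (cong₂ _∨_ (∧-identityʳ (adj H₁ a b)) (∧-zeroʳ ⌊ a ≟ b ⌋)) (∨-identityʳ (adj H₁ a b))

  adjW-φ₂ : ∀ {a b} → adj H₂ a b ≡ true → adjW (φ₂ a) (φ₂ b) ≡ true
  adjW-φ₂ {a} {b} e rewrite ρ₁-φ₂ a | ρ₁-φ₂ b | ρ₂-φ₂ a | ρ₂-φ₂ b = ∨-introʳ e

  module _ (C₁ : Connected H₁) (C₂ : Connected H₂) where

    ℓ : V → V → ℕ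
    ℓ u v = dist H₁ (ρ₁ u) (ρ₁ v) +ℕ dist H₂ (ρ₂ u) (ρ₂ v)

    ℓ-coordinates : ∀ u v {a b c d} → ρ₁ u ≡ a → ρ₁ v ≡ b → ρ₂ u ≡ c → ρ₂ v ≡ d →
                    ℓ u v ≡ dist H₁ a b +ℕ dist H₂ c d
    ℓ-coordinates u v refl refl refl refl = refl

    ℓ-φ₁ : ∀ a b → ℓ (φ₁ a) (φ₁ b) ≡ dist H₁ a b
    ℓ-φ₁ a b = trans (ℓ-coordinates (φ₁ a) (φ₁ b) (ρ₁-φ₁ a) (ρ₁-φ₁ b) (ρ₂-φ₁ a) (ρ₂-φ₁ b)) (+-identityʳ _)

    ℓ-step : ∀ u p q → adjW p q ≡ true → ℓ u q ≤ suc (ℓ u p)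
    ℓ-step u p q e with adjW-split p q e
    ... | inj₁ (e₁ , ρ₂p≡ρ₂q) rewrite ρ₂p≡ρ₂q = +-monoˡ-≤ _ (dist-step H₁ C₁ (ρ₁ u) (ρ₁ p) (ρ₁ q) e₁)
    ... | inj₂ (ρ₁p≡ρ₁q , e₂) rewrite ρ₁p≡ρ₁q =
      ≤-trans (+-monoʳ-≤ _ (dist-step H₂ C₂ (ρ₂ u) (ρ₂ p) (ρ₂ q) e₂)) (≤-reflexive (+-suc _ _))

    ℓ-≤ : ∀ {k u v} → Walk≤ W k u v → ℓ u v ≤ k
    ℓ-≤ {k} {u} {v} p = subst (ℓ u v ≤_) k+ℓuu≡k (walk-lipschitz W (ℓ u) (ℓ-step u) p)
      where
      k+ℓuu≡k : k +ℕ ℓ u u ≡ k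
      k+ℓuu≡k = trans (cong (k +ℕ_) (cong₂ _+ℕ_ (dist-self H₁ (ρ₁ u)) (dist-self H₂ (ρ₂ u)))) (+-identityʳ k)

    walk₁ : ∀ a b → Walk≤ W (dist H₁ a b) (φ₁ a) (φ₁ b)
    walk₁ a b = walk-map φ₁ (λ {a} {b} e → trans (adjW-φ₁ a b) e) (dist-walk H₁ C₁ a b)

    walk₂ : ∀ a b → Walk≤ W (dist H₂ a b) (φ₂ a) (φ₂ b)
    walk₂ a b = walk-map φ₂ adjW-φ₂ (dist-walk H₂ C₂ a b)

    -- A walk inside one side, or through the root, has length exactly ℓ.
    ℓ-walk : ∀ u v → Walk≤ W (ℓ u v) u v
    ℓ-walk u v with view u | view v
    ... | left a  | left b  = walk-cast W (sym (ℓ-φ₁ a b)) (walk₁ a b)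
    ... | left a  | right d = walk-cast W
            (trans (+ℕ-comm (dist H₂ zero (suc d)) (dist H₁ a zero))
                   (sym (ℓ-coordinates (φ₁ a) (φ₂ (suc d))
                                       (ρ₁-φ₁ a) (ρ₁-φ₂ (suc d)) (ρ₂-φ₁ a) (ρ₂-φ₂ (suc d)))))
            (_++_ W (walk₁ a zero) (walk₂ zero (suc d)))
    ... | right c | left b  = walk-cast W
            (sym (ℓ-coordinates (φ₂ (suc c)) (φ₁ b)
                                (ρ₁-φ₂ (suc c)) (ρ₁-φ₁ b) (ρ₂-φ₂ (suc c)) (ρ₂-φ₁ b)))
            (_++_ W (walk₂ (suc c) zero) (walk₁ zero b))
    ... | right c | right d = walk-cast W
            (sym (ℓ-coordinates (φ₂ (suc c)) (φ₂ (suc d))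
                                (ρ₁-φ₂ (suc c)) (ρ₁-φ₂ (suc d)) (ρ₂-φ₂ (suc c)) (ρ₂-φ₂ (suc d))))
            (walk₂ (suc c) (suc d))

    W-connected : Connected W
    W-connected u v = ℓ u v , walk⇒reach W (ℓ-walk u v)

    dist-W : ∀ u v → dist W u v ≡ ℓ u v
    dist-W u v = ≤-antisym (dist-≤ W (ℓ-walk u v)) (ℓ-≤ (dist-walk W W-connected u v))

  sum-V : ∀ (F : Fin (suc m₁) ⊎ Fin m₂ → ℚ) →
          sum (λ v → F (splitAt (suc m₁) v)) ≡ sum (λ a → F (inj₁ a)) + sum (λ c → F (inj₂ c))
  sum-V F = trans (sum-splitAt (suc m₁) (λ v → F (splitAt (suc m₁) v)))
                  (cong₂ _+_ (sum-cong-≗ (λ a → cong F (splitAt-↑ˡ (suc m₁) a m₂)))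
                             (sum-cong-≗ (λ c → cong F (splitAt-↑ʳ (suc m₁) m₂ c))))

  module _ {ι₁ ι₂ : ℚ} (h₁ : HasIndex H₁ ι₁) (h₂ : HasIndex H₂ ι₂) where

    open HasIndex h₁ renaming (weight to y₁; row to row₁; total to total₁)
    open HasIndex h₂ renaming (weight to y₂; row to row₂; total to total₂)
    open ≡-Reasoning

    -- Subtracting 1 at the root keeps the total weight 1.
    y₁′ : Fin (suc m₁) → ℚ
    y₁′ zero    = (y₁ zero + y₂ zero) - 1ℚ
    y₁′ (suc i) = y₁ (suc i)

    y : V → ℚ
    y v = [ y₁′ , (λ c → y₂ (suc c)) ]′ (splitAt (suc m₁) v)

    cancel : ∀ a b T → b + T ≡ 1ℚ → ((a + b) - 1ℚ) + T ≡ a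
    cancel a b T b+T≡1 = begin
      ((a + b) - 1ℚ) + T
        ≡⟨ solve 3 (λ a b T → ((a :+ b) :- con 1ℚ) :+ T := a :+ ((b :+ T) :- con 1ℚ)) refl a b T ⟩
      a + ((b + T) - 1ℚ)
        ≡⟨ cong (λ t → a + (t - 1ℚ)) b+T≡1 ⟩
      a + (1ℚ - 1ℚ)
        ≡⟨ solve 1 (λ a → a :+ (con 1ℚ :- con 1ℚ) := a) refl a ⟩
      a ∎
      where open +-*-Solver

    pushforward₁ : ∀ (f : Fin (suc m₁) → ℚ) → sum (λ v → f (ρ₁ v) * y v) ≡ sum (λ a → f a * y₁ a)
    pushforward₁ f = begin
      sum (λ v → f (ρ₁ v) * y v)
        ≡⟨ sum-V (λ s → f ([ (λ a → a) , (λ _ → zero) ]′ s) * [ y₁′ , (λ c → y₂ (suc c)) ]′ s) ⟩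
      (f zero * y₁′ zero + S) + sum (λ c → f zero * y₂ (suc c))
        ≡⟨ cong ((f zero * y₁′ zero + S) +_) (sym (*-distribˡ-sum (f zero) (λ c → y₂ (suc c)))) ⟩
      (f zero * y₁′ zero + S) + f zero * sum (λ c → y₂ (suc c))
        ≡⟨ solve 4 (λ f₀ y S T → (f₀ :* y :+ S) :+ f₀ :* T := f₀ :* (y :+ T) :+ S) refl
                   (f zero) (y₁′ zero) S (sum (λ c → y₂ (suc c))) ⟩
      f zero * (y₁′ zero + sum (λ c → y₂ (suc c))) + S
        ≡⟨ cong (λ t → f zero * t + S) (cancel (y₁ zero) (y₂ zero) _ total₂) ⟩
      f zero * y₁ zero + S
        ∎
      where
      open +-*-Solver
      S : ℚ
      S = sum (λ i → f (suc i) * y₁ (suc i))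

    pushforward₂ : ∀ (g : Fin (suc m₂) → ℚ) → sum (λ v → g (ρ₂ v) * y v) ≡ sum (λ b → g b * y₂ b)
    pushforward₂ g = begin
      sum (λ v → g (ρ₂ v) * y v)
        ≡⟨ sum-V (λ s → g ([ (λ _ → zero) , suc ]′ s) * [ y₁′ , (λ c → y₂ (suc c)) ]′ s) ⟩
      sum (λ a → g zero * y₁′ a) + S
        ≡⟨ cong (_+ S) (sym (*-distribˡ-sum (g zero) y₁′)) ⟩
      g zero * sum y₁′ + S
        ≡⟨ cong (λ t → g zero * (t + sum (λ i → y₁ (suc i))) + S) (cong (_- 1ℚ) (+-comm (y₁ zero) (y₂ zero))) ⟩
      g zero * (((y₂ zero + y₁ zero) - 1ℚ) + sum (λ i → y₁ (suc i))) + S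
        ≡⟨ cong (λ t → g zero * t + S) (cancel (y₂ zero) (y₁ zero) _ total₁) ⟩
      g zero * y₂ zero + S
        ∎
      where
      S : ℚ
      S = sum (λ c → g (suc c) * y₂ (suc c))

    module _ (C₁ : Connected H₁) (C₂ : Connected H₂) where

      W-row : ∀ u → sum (λ v → ℕtoℚ (dist W u v) * y v) ≡ ι₁ + ι₂
      W-row u = begin
        sum (λ v → ℕtoℚ (dist W u v) * y v)
          ≡⟨ sum-cong-≗ split ⟩
        sum (λ v → D₁ (ρ₁ v) * y v + D₂ (ρ₂ v) * y v)
          ≡⟨ ∑-distrib-+ (λ v → D₁ (ρ₁ v) * y v) (λ v → D₂ (ρ₂ v) * y v) ⟩
        sum (λ v → D₁ (ρ₁ v) * y v) + sum (λ v → D₂ (ρ₂ v) * y v)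
          ≡⟨ cong₂ _+_ (pushforward₁ D₁) (pushforward₂ D₂) ⟩
        sum (λ a → D₁ a * y₁ a) + sum (λ b → D₂ b * y₂ b)
          ≡⟨ cong₂ _+_ (row₁ (ρ₁ u)) (row₂ (ρ₂ u)) ⟩
        ι₁ + ι₂
          ∎
        where
        D₁ : Fin (suc m₁) → ℚ
        D₁ a = ℕtoℚ (dist H₁ (ρ₁ u) a)
        D₂ : Fin (suc m₂) → ℚ
        D₂ b = ℕtoℚ (dist H₂ (ρ₂ u) b)
        split : ∀ v → ℕtoℚ (dist W u v) * y v ≡ D₁ (ρ₁ v) * y v + D₂ (ρ₂ v) * y v
        split v = begin
          ℕtoℚ (dist W u v) * y v
            ≡⟨ cong (λ k → ℕtoℚ k * y v) (dist-W C₁ C₂ u v) ⟩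
          ℕtoℚ (dist H₁ (ρ₁ u) (ρ₁ v) +ℕ dist H₂ (ρ₂ u) (ρ₂ v)) * y v
            ≡⟨ cong (_* y v) (ℕtoℚ-+ (dist H₁ (ρ₁ u) (ρ₁ v)) (dist H₂ (ρ₂ u) (ρ₂ v))) ⟩
          (D₁ (ρ₁ v) + D₂ (ρ₂ v)) * y v
            ≡⟨ *-distribʳ-+ (y v) (D₁ (ρ₁ v)) (D₂ (ρ₂ v)) ⟩
          D₁ (ρ₁ v) * y v + D₂ (ρ₂ v) * y v
            ∎

      W-index : HasIndex W (ι₁ + ι₂)
      W-index = record
        { weight = y
        ; row    = W-row
        ; total  = begin
            sum y                  ≡⟨ sum-cong-≗ (λ v → sym (*-identityˡ (y v))) ⟩
            sum (λ v → 1ℚ * y v)   ≡⟨ pushforward₁ (λ _ → 1ℚ) ⟩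
            sum (λ a → 1ℚ * y₁ a)  ≡⟨ sum-cong-≗ (λ a → *-identityˡ (y₁ a)) ⟩
            sum y₁                 ≡⟨ total₁ ⟩
            1ℚ                     ∎
        }

_⋁_ : RootedGraph → RootedGraph → RootedGraph
G₁ ⋁ G₂ = record { m = m₁ +ℕ m₂ ; edge = adjW ; edge-sym = adjW-sym ; edge-irr = adjW-irr }
  where open Wedge G₁ G₂

_↪_ : Graph → Graph → Set
G ↪ H = Σ (Fin (n G) → Fin (n H)) λ f → InducedEmbedding G H f × Isometric G H f

↪-refl : ∀ {G} → G ↪ G
↪-refl = (λ v → v) , ((λ e → e) , (λ _ _ → refl)) , (λ _ _ → refl)

↪-trans : ∀ {G H K} → G ↪ H → H ↪ K → G ↪ K
↪-trans (f , (f-injective , f-adj) , f-isometric) (g , (g-injective , g-adj) , g-isometric) =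
  (λ v → g (f v)) ,
  ((λ e → f-injective (g-injective e)) , (λ u v → trans (g-adj (f u) (f v)) (f-adj u v))) ,
  (λ u v → trans (g-isometric (f u) (f v)) (f-isometric u v))

record Indexed (ι : ℚ) : Set where
  field
    graph     : RootedGraph
    connected : Connected ⌞ graph ⌟
    index     : HasIndex ⌞ graph ⌟ ι

open Indexed

_⋁ᵢ_ : ∀ {ι κ} → Indexed ι → Indexed κ → Indexed (ι + κ)
G ⋁ᵢ H = record
  { graph     = graph G ⋁ graph H
  ; connected = W-connected (connected G) (connected H)
  ; index     = W-index (index G) (index H) (connected G) (connected H)
  }
  where open Wedge (graph G) (graph H)

⋁ᵢ-↪ : ∀ {ι κ} (G : Indexed ι) (H : Indexed κ) → ⌞ graph G ⌟ ↪ ⌞ graph (G ⋁ᵢ H) ⌟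
⋁ᵢ-↪ G H = φ₁ , ((λ {a} {b} → ↑ˡ-injective m₂ a b) , adjW-φ₁) ,
           λ a b → trans (dist-W C₁ C₂ (φ₁ a) (φ₁ b)) (ℓ-φ₁ C₁ C₂ a b)
  where
  open Wedge (graph G) (graph H)
  C₁ : Connected H₁
  C₁ = connected G
  C₂ : Connected H₂
  C₂ = connected H

reindex : ∀ {ι κ} → ι ≡ κ → Indexed ι → Indexed κ
reindex ι≡κ G = record
  { graph = graph G ; connected = connected G ; index = subst (HasIndex ⌞ graph G ⌟) ι≡κ (index G) }

infixl 6 _⋁[_]_

_⋁[_]_ : ∀ {ι κ} → Indexed ι → (c : ℕ) → Indexed κ → Indexed (ι + ℕtoℚ c * κ)
_⋁[_]_ {ι} {κ} T zero X    = reindex (solve 2 (λ ι κ → ι := ι :+ con 0ℚ :* κ) refl ι κ) T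
  where open +-*-Solver
_⋁[_]_ {ι} {κ} T (suc c) X = reindex one-more ((T ⋁[ c ] X) ⋁ᵢ X)
  where
  open +-*-Solver
  one-more : (ι + ℕtoℚ c * κ) + κ ≡ ι + ℕtoℚ (suc c) * κ
  one-more = trans (solve 3 (λ ι c κ → (ι :+ c :* κ) :+ κ := ι :+ (con 1ℚ :+ c) :* κ) refl ι (ℕtoℚ c) κ)
                   (cong (λ t → ι + t * κ) (sym (ℕtoℚ-suc c)))

⋁[]-↪ : ∀ {ι κ} (T : Indexed ι) c (X : Indexed κ) → ⌞ graph T ⌟ ↪ ⌞ graph (T ⋁[ c ] X) ⌟
⋁[]-↪ T zero    X = ↪-refl
⋁[]-↪ T (suc c) X = ↪-trans (⋁[]-↪ T c X) (⋁ᵢ-↪ (T ⋁[ c ] X) X)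

-- Cancelling the index

K₂-edge : Fin 2 → Fin 2 → Bool
K₂-edge _ _ = true

K₂ : Indexed ½
K₂ = record
  { graph     = K₂-graph
  ; connected = universal⇒connected ⌞ K₂-graph ⌟ 0F λ { 0F 0≢0 → contradiction refl 0≢0 ; (suc v) _ → refl }
  ; index     = record { weight = λ _ → ½ ; row = λ { 0F → refl ; 1F → refl } ; total = refl }
  }
  where
  K₂-graph : RootedGraph
  K₂-graph = record
    { m = 1 ; edge = symmetrise K₂-edge ; edge-sym = symmetrise-sym K₂-edge ; edge-irr = symmetrise-irr K₂-edge }

N-edge : Fin 7 → Fin 7 → Bool
N-edge 0F _  = true
N-edge 1F _  = true
N-edge 2F _  = true
N-edge 3F 4F = true
N-edge _  _  = false

N : Indexed (- 1ℚ)
N = record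
  { graph     = N-graph
  ; connected = universal⇒connected ⌞ N-graph ⌟ 0F universal
  ; index     = record { weight = weight ; row = row ; total = refl }
  }
  where
  N-graph : RootedGraph
  N-graph = record
    { m = 6 ; edge = symmetrise N-edge ; edge-sym = symmetrise-sym N-edge ; edge-irr = symmetrise-irr N-edge }
  universal : ∀ v → 0F ≢ v → symmetrise N-edge 0F v ≡ true
  universal 0F      0≢0 = contradiction refl 0≢0
  universal (suc v) _   = refl
  weight : Fin 7 → ℚ
  weight 0F = ℤ.+ 2 / 1
  weight 1F = ℤ.+ 2 / 1
  weight 2F = ℤ.+ 2 / 1
  weight 3F = - 1ℚ
  weight 4F = - 1ℚ
  weight 5F = - (ℤ.+ 3 / 2)
  weight 6F = - (ℤ.+ 3 / 2)
  row : ∀ i → sum (λ j → ℕtoℚ (dist ⌞ N-graph ⌟ i j) * weight j) ≡ - 1ℚ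
  row 0F = refl
  row 1F = refl
  row 2F = refl
  row 3F = refl
  row 4F = refl
  row 5F = refl
  row 6F = refl

ℕtoℚ-suc-*-mkℚ : ∀ z d .(c : Coprimality.Coprime ℤ.∣ z ∣ (suc d)) →
                 ℕtoℚ (suc d) * mkℚ z d c ≡ mkℚ z 0 (Coprimality.sym (Coprimality.1-coprimeTo ℤ.∣ z ∣))
ℕtoℚ-suc-*-mkℚ z d c = toℚᵘ-injective
  (ℚᵘ.≃-trans (toℚᵘ-homo-* (ℕtoℚ (suc d)) (mkℚ z d c))
  (ℚᵘ.≃-trans (ℚᵘ.*-congʳ (toℚᵘ-cong (ℕtoℚ≡mkℚ (suc d))))
              (*≡* (solve 2 (λ D Z → (D :* Z) :* con (ℤ.+ 1) := Z :* (con (ℤ.+ 1) :* D)) refl (ℤ.+ suc d) z))))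
  where open Data.Integer.Solver.+-*-Solver

clear-denominator : ∀ r → ∃₂ λ d a → ℕtoℚ (suc d) * r ≡ ℕtoℚ a ⊎ ℕtoℚ (suc d) * r ≡ - ℕtoℚ a
clear-denominator (mkℚ (ℤ.+ a) d c) =
  d , a , inj₁ (trans (ℕtoℚ-suc-*-mkℚ (ℤ.+ a) d c) (sym (ℕtoℚ≡mkℚ a)))
clear-denominator (mkℚ ℤ.-[1+ a ] d c) =
  d , suc a , inj₂ (trans (ℕtoℚ-suc-*-mkℚ ℤ.-[1+ a ] d c) (cong -_ (sym (ℕtoℚ≡mkℚ (suc a)))))

ℕtoℚ-suc-* : ∀ d r → ℕtoℚ (suc d) * r ≡ r + ℕtoℚ d * r
ℕtoℚ-suc-* d r = trans (cong (_* r) (ℕtoℚ-suc d))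
                       (solve 2 (λ d r → (con 1ℚ :+ d) :* r := r :+ d :* r) refl (ℕtoℚ d) r)
  where open +-*-Solver

wedge-cancelling : ∀ {r κ} (G : Indexed r) d c (X : Indexed κ) → (r + ℕtoℚ d * r) + ℕtoℚ c * κ ≡ 0ℚ →
                   Σ (Indexed 0ℚ) λ T → ⌞ graph G ⌟ ↪ ⌞ graph T ⌟
wedge-cancelling G d c X cancels =
  reindex cancels (G ⋁[ d ] G ⋁[ c ] X) , ↪-trans (⋁[]-↪ G d G) (⋁[]-↪ (G ⋁[ d ] G) c X)

index-cancellation : ∀ {r} (G : Indexed r) → Σ (Indexed 0ℚ) λ T → ⌞ graph G ⌟ ↪ ⌞ graph T ⌟
index-cancellation {r} G with clear-denominator r
... | d , a , inj₁ [d+1]r≡a = wedge-cancelling G d a N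
  (trans (cong (_+ ℕtoℚ a * (- 1ℚ)) (trans (sym (ℕtoℚ-suc-* d r)) [d+1]r≡a))
         (solve 1 (λ a → a :+ a :* con (- 1ℚ) := con 0ℚ) refl (ℕtoℚ a)))
  where open +-*-Solver
... | d , a , inj₂ [d+1]r≡-a = wedge-cancelling G d (a +ℕ a) K₂
  (trans (cong₂ (λ s t → s + t * ½) (trans (sym (ℕtoℚ-suc-* d r)) [d+1]r≡-a) (ℕtoℚ-+ a a))
         (solve 1 (λ a → :- a :+ (a :+ a) :* con ½ := con 0ℚ) refl (ℕtoℚ a)))
  where open +-*-Solver

potential⇒exceptional-extension : ∀ G → Connected G → ∀ x → IsCurvaturePotential G x → ¬ Σℚ x ≡ 0ℚ →
                                  Σ Graph λ G′ → DistanceExceptional G′ × G ↪ G′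
potential⇒exceptional-extension record { n = zero } C x potential nz = contradiction refl nz
potential⇒exceptional-extension G@record { n = suc m ; adj = adj ; sym = sym ; irr = irr } C x potential nz
  with index-cancellation (record
         { graph     = record { m = m ; edge = adj ; edge-sym = sym ; edge-irr = irr }
         ; connected = C
         ; index     = potential⇒index G x potential nz
         })
... | H , G↪H = ⌞ graph H ⌟ , index-zero⇒exceptional ⌞ graph H ⌟ (connected H) (index H) , G↪H

theorem5p3 : (G : Graph) →
    (Σ Graph λ G' → DistanceExceptional G' ×
       Σ (Fin (n G) → Fin (n G')) λ f → InducedEmbedding G G' f)
    × (Connected G → IotaFinite G →
       Σ Graph λ G' → DistanceExceptional G' ×
         Σ (Fin (n G) → Fin (n G')) λ f → InducedEmbedding G G' f × Isometric G G' f)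
theorem5p3 G = (G⁺ , G⁺-exceptional , (7 ↑ʳ_) , G⁺-induced) , isometric
  where
  open Gadget G
  isometric : Connected G → IotaFinite G → Σ Graph λ G′ → DistanceExceptional G′ × G ↪ G′
  isometric C (inj₁ exceptional)          = G , exceptional , ↪-refl
  isometric C (inj₂ (x , potential , nz)) = potential⇒exceptional-extension G C x potential nz
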